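{- Let $\Gamma$ be a set of patterns and $\varphi$ a pattern. If $\Gamma\vdash\varphi$ in the proof system $\mathcal P_{l}$ described in the context, then $\varphi$ is a local semantic consequence of $\Gamma$: for every structure $\mathcal A$ and every $\mathcal A$-valuation $e$, if $\bar e(\gamma)=A$ for all $\gamma\in\Gamma$, then $\bar e(\varphi)=A$.
   Context: Signature: pairwise disjoint sets $EVar$ (element variables), $SVar$ (set variables), both countably infinite, and a set $\Sigma$ of constants. Patterns: $\varphi ::= x \mid X \mid \sigma \mid \varphi\,\varphi \mid \varphi\to\varphi \mid \exists x.\varphi \mid \mu X.\varphi$ (application $\varphi\,\psi$; no positivity restriction on $\mu$). $\exists x$ binds $x$, $\mu X$ binds $X$; $FV(\varphi)$ = free variables. Abbreviations: $\bot:=\mu X.X$, $\neg\varphi:=\varphi\to\bot$, $\varphi\vee\psi:=\neg\varphi\to\psi$, $\varphi\wedge\psi:=\neg(\neg\varphi\vee\neg\psi)$; $\exists x.\psi\,\varphi$ means $\exists x.(\psi\,\varphi)$. Semantics: structure $\mathcal A=(A,\cdot,(\sigma^{\mathcal A}))$ with $A\ne\emptyset$, $\cdot:A\times A\to2^A$, $\sigma^{\mathcal A}\subseteq A$; $B\cdot C:=\bigcup_{b\in B,c\in C}b\cdot c$. Valuations $e$ send element variables into $A$ and set variables to subsets of $A$; $e[a/x],e[B/X]$ updates. $\bar e(x)=\{e(x)\}$, $\bar e(X)=e(X)$, $\bar e(\sigma)=\sigma^{\mathcal A}$, $\bar e(\varphi\psi)=\bar e(\varphi)\cdot\bar e(\psi)$,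 $\bar e(\varphi\to\psi)=A\setminus(\bar e(\varphi)\setminus\bar e(\psi))$, $\bar e(\exists x.\varphi)=\bigcup_{a}\overline{e[a/x]}(\varphi)$, $\bar e(\mu X.\varphi)=\bigcap\{B\subseteq A:\overline{e[B/X]}(\varphi)\subseteq B\}$. Substitution $\varphi[\delta/x]$, $\varphi[\delta/X]$: replace free occurrences. $x$ (resp. $X$) is free for $\delta$ in $\varphi$ if no free occurrence of it lies within the scope $\theta$ of a subpattern $\exists z.\theta$ with $z\in FV(\delta)$ or $\mu Z.\theta$ with $Z\in FV(\delta)$. $\varphi$ is positive in $X$ if every free occurrence of $X$ lies within the left argument of an even number of implication subpatterns. Tautology: $F(\varphi)=A$ for every structure and every map $F$ from patterns to $2^A$ with $F(\bot)=\emptyset$, $F(\psi\to\chi)=A\setminus(F(\psi)\setminus F(\chi))$. Contexts: $C::=\Box\mid C\,\varphi\mid\varphi\,C$, with $C[\delta]$ replacing $\Box$ by $\delta$. Proof system $\mathcal P_l$. Axioms: all tautologies; $\varphi[y/x]\to\exists x.\varphi$ if $x$ is free for the element variable $y$ in $\varphi$; $\varphi\,\bot\to\bot$, $\bot\,\varphi\to\bot$; $(\varphi\vee\psi)\chi\to\varphi\chi\vee\psi\chi$, $\chi(\varphi\vee\psi)\to\chi\varphi\vee\chi\psi$; $(\exists x.\varphi)\psi\to\exists x.(\varphi\psi)$ and $\psi(\exists x.\varphi)\to\exists x.(\psi\varphi)$ if $x\notin FV(\psi)$; $\varphi[\mu X.\varphi/X]\to\mu X.\varphi$ if $\varphi$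 is positive in $X$ and $X$ is free for $\mu X.\varphi$ in $\varphi$; $\exists x.x$; $\neg(C_1[x\wedge\varphi]\wedge C_2[x\wedge\neg\varphi])$ for contexts $C_1,C_2$. Rules: modus ponens (from $\varphi$, $\varphi\to\psi$ infer $\psi$); framing (from $\varphi\to\psi$ infer $\varphi\chi\to\psi\chi$ and $\chi\varphi\to\chi\psi$); Knaster–Tarski (from $\varphi[\psi/X]\to\psi$ infer $\mu X.\varphi\to\psi$ if $X$ is free for $\psi$ in $\varphi$). $\Gamma\vdash\varphi$ means $\varphi$ belongs to the smallest set containing the axioms and $\Gamma$ and closed under these rules. -}

module Defs where

open import Data.Nat using (ℕ; _≟_)
open import Data.Bool using (Bool; true; false; not; _∧_; if_then_else_)
open import Data.Product using (Σ; ∃; _×_; _,_)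
open import Data.Unit using (⊤)
open import Relation.Nullary using (Dec; ¬_; does)
open import Relation.Binary.PropositionalEquality using (_≡_; _≢_)

-- Metatheoretic classical oracle (the paper's metatheory is classical).
-- Subsets of a carrier A are represented as Bool-valued predicates
-- A → Bool; the oracle is used to decide the (Set-level) conditions
-- defining ∃, application and least fixpoints.

Oracle : Set₁
Oracle = (P : Set) → Dec P

EVar : Set
EVar = ℕ

SVar : Set
SVar = ℕ

data Pattern (Sig : Set) : Set where
  evar : EVar → Pattern Sig
  svar : SVar → Pattern Sig
  sym  : Sig → Pattern Sig
  app  : Pattern Sig → Pattern Sig → Pattern Sig
  _⇒_  : Pattern Sig → Pattern Sig → Pattern Sig
  ex   : EVar → Pattern Sig → Pattern Sig
  mu   : SVar → Pattern Sig → Pattern Sig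

infixr 5 _⇒_

module _ {Sig : Set} where

  ⊥ᵖ : Pattern Sig
  ⊥ᵖ = mu 0 (svar 0)

  ¬ᵖ_ : Pattern Sig → Pattern Sig
  ¬ᵖ φ = φ ⇒ ⊥ᵖ

  _∨ᵖ_ : Pattern Sig → Pattern Sig → Pattern Sig
  φ ∨ᵖ ψ = (¬ᵖ φ) ⇒ ψ

  _∧ᵖ_ : Pattern Sig → Pattern Sig → Pattern Sig
  φ ∧ᵖ ψ = ¬ᵖ ((¬ᵖ φ) ∨ᵖ (¬ᵖ ψ))

  _∈FVₑ_ : EVar → Pattern Sig → Set
  x ∈FVₑ evar y = x ≡ y
  x ∈FVₑ svar Y = Data.Empty.⊥ where import Data.Empty
  x ∈FVₑ sym σ = Data.Empty.⊥ where import Data.Empty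
  x ∈FVₑ app φ ψ = (x ∈FVₑ φ) Data.Sum.⊎ (x ∈FVₑ ψ) where import Data.Sum
  x ∈FVₑ (φ ⇒ ψ) = (x ∈FVₑ φ) Data.Sum.⊎ (x ∈FVₑ ψ) where import Data.Sum
  x ∈FVₑ ex y φ = (x ≢ y) × (x ∈FVₑ φ)
  x ∈FVₑ mu Y φ = x ∈FVₑ φ

  _∈FVₛ_ : SVar → Pattern Sig → Set
  X ∈FVₛ evar y = Data.Empty.⊥ where import Data.Empty
  X ∈FVₛ svar Y = X ≡ Y
  X ∈FVₛ sym σ = Data.Empty.⊥ where import Data.Empty
  X ∈FVₛ app φ ψ = (X ∈FVₛ φ) Data.Sum.⊎ (X ∈FVₛ ψ) where import Data.Sum
  X ∈FVₛ (φ ⇒ ψ) = (X ∈FVₛ φ) Data.Sum.⊎ (X ∈FVₛ ψ) where import Data.Sum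
  X ∈FVₛ ex y φ = X ∈FVₛ φ
  X ∈FVₛ mu Y φ = (X ≢ Y) × (X ∈FVₛ φ)

  -- Substitution (replace free occurrences; no renaming of binders)
  _[_/ₑ_] : Pattern Sig → Pattern Sig → EVar → Pattern Sig
  evar y [ δ /ₑ x ] = if does (y ≟ x) then δ else evar y
  svar Y [ δ /ₑ x ] = svar Y
  sym σ [ δ /ₑ x ] = sym σ
  app φ ψ [ δ /ₑ x ] = app (φ [ δ /ₑ x ]) (ψ [ δ /ₑ x ])
  (φ ⇒ ψ) [ δ /ₑ x ] = (φ [ δ /ₑ x ]) ⇒ (ψ [ δ /ₑ x ])
  ex y φ [ δ /ₑ x ] = if does (y ≟ x) then ex y φ else ex y (φ [ δ /ₑ x ])
  mu Y φ [ δ /ₑ x ] = mu Y (φ [ δ /ₑ x ])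

  _[_/ₛ_] : Pattern Sig → Pattern Sig → SVar → Pattern Sig
  evar y [ δ /ₛ X ] = evar y
  svar Y [ δ /ₛ X ] = if does (Y ≟ X) then δ else svar Y
  sym σ [ δ /ₛ X ] = sym σ
  app φ ψ [ δ /ₛ X ] = app (φ [ δ /ₛ X ]) (ψ [ δ /ₛ X ])
  (φ ⇒ ψ) [ δ /ₛ X ] = (φ [ δ /ₛ X ]) ⇒ (ψ [ δ /ₛ X ])
  ex y φ [ δ /ₛ X ] = ex y (φ [ δ /ₛ X ])
  mu Y φ [ δ /ₛ X ] = if does (Y ≟ X) then mu Y φ else mu Y (φ [ δ /ₛ X ])

  FreeForₑ : EVar → Pattern Sig → Pattern Sig → Set
  FreeForₑ x δ (evar y) = ⊤
  FreeForₑ x δ (svar Y) = ⊤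
  FreeForₑ x δ (sym σ) = ⊤
  FreeForₑ x δ (app φ ψ) = FreeForₑ x δ φ × FreeForₑ x δ ψ
  FreeForₑ x δ (φ ⇒ ψ) = FreeForₑ x δ φ × FreeForₑ x δ ψ
  FreeForₑ x δ (ex z θ) =
    if does (z ≟ x) then ⊤
    else ((z ∈FVₑ δ → ¬ (x ∈FVₑ θ)) × FreeForₑ x δ θ)
  FreeForₑ x δ (mu Z θ) = (Z ∈FVₛ δ → ¬ (x ∈FVₑ θ)) × FreeForₑ x δ θ

  FreeForₛ : SVar → Pattern Sig → Pattern Sig → Set
  FreeForₛ X δ (evar y) = ⊤
  FreeForₛ X δ (svar Y) = ⊤
  FreeForₛ X δ (sym σ) = ⊤
  FreeForₛ X δ (app φ ψ) = FreeForₛ X δ φ × FreeForₛ X δ ψ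
  FreeForₛ X δ (φ ⇒ ψ) = FreeForₛ X δ φ × FreeForₛ X δ ψ
  FreeForₛ X δ (ex z θ) = (z ∈FVₑ δ → ¬ (X ∈FVₛ θ)) × FreeForₛ X δ θ
  FreeForₛ X δ (mu Z θ) =
    if does (Z ≟ X) then ⊤
    else ((Z ∈FVₛ δ → ¬ (X ∈FVₛ θ)) × FreeForₛ X δ θ)

  Positive Negative : SVar → Pattern Sig → Set
  Positive X (evar y) = ⊤
  Positive X (svar Y) = ⊤
  Positive X (sym σ) = ⊤
  Positive X (app φ ψ) = Positive X φ × Positive X ψ
  Positive X (φ ⇒ ψ) = Negative X φ × Positive X ψ
  Positive X (ex y φ) = Positive X φ
  Positive X (mu Y φ) = if does (Y ≟ X) then ⊤ else Positive X φ
  Negative X (evar y) = ⊤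
  Negative X (svar Y) = Y ≢ X
  Negative X (sym σ) = ⊤
  Negative X (app φ ψ) = Negative X φ × Negative X ψ
  Negative X (φ ⇒ ψ) = Positive X φ × Negative X ψ
  Negative X (ex y φ) = Negative X φ
  Negative X (mu Y φ) = if does (Y ≟ X) then ⊤ else Negative X φ

  data Ctx : Set where
    □    : Ctx
    ctxL : Ctx → Pattern Sig → Ctx
    ctxR : Pattern Sig → Ctx → Ctx

  plug : Ctx → Pattern Sig → Pattern Sig
  plug □ δ = δ
  plug (ctxL C φ) δ = app (plug C δ) φ
  plug (ctxR φ C) δ = app φ (plug C δ)

record Structure (Sig : Set) : Set₁ where
  field
    Carrier  : Set
    inhabited : Carrier
    -- appl a b c = true  iff  c ∈ a · b
    appl     : Carrier → Carrier → Carrier → Bool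
    interp   : Sig → Carrier → Bool

record Valuation {Sig : Set} (M : Structure Sig) : Set where
  field
    valE : EVar → Structure.Carrier M
    valS : SVar → Structure.Carrier M → Bool

module _ {Sig : Set} {M : Structure Sig} where
  open Structure M

  _[_/ₑv_] : Valuation M → Carrier → EVar → Valuation M
  e [ a /ₑv x ] = record
    { valE = λ y → if does (y ≟ x) then a else Valuation.valE e y
    ; valS = Valuation.valS e }

  _[_/ₛv_] : Valuation M → (Carrier → Bool) → SVar → Valuation M
  e [ B /ₛv X ] = record
    { valE = Valuation.valE e
    ; valS = λ Y → if does (Y ≟ X) then B else Valuation.valS e Y }

⌊_⌋ : {P : Set} → Dec P → Bool
⌊ d ⌋ = does d

⟦_⟧ : {Sig : Set} → Oracle → {M : Structure Sig} →
      Pattern Sig → Valuation M → Structure.Carrier M → Bool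
⟦ dec ⟧ {M} (evar x) e a = ⌊ dec (a ≡ Valuation.valE e x) ⌋
⟦ dec ⟧ {M} (svar X) e a = Valuation.valS e X a
⟦ dec ⟧ {M} (sym σ) e a = Structure.interp M σ a
⟦ dec ⟧ {M} (app φ ψ) e a =
  ⌊ dec (Σ (Structure.Carrier M) λ b → Σ (Structure.Carrier M) λ c →
          (⟦ dec ⟧ φ e b ≡ true) × (⟦ dec ⟧ ψ e c ≡ true) ×
          (Structure.appl M b c a ≡ true)) ⌋
⟦ dec ⟧ {M} (φ ⇒ ψ) e a = not (⟦ dec ⟧ φ e a ∧ not (⟦ dec ⟧ ψ e a))
⟦ dec ⟧ {M} (ex x φ) e a =
  ⌊ dec (Σ (Structure.Carrier M) λ b → ⟦ dec ⟧ φ (e [ b /ₑv x ]) a ≡ true) ⌋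
⟦ dec ⟧ {M} (mu X φ) e a =
  ⌊ dec ((B : Structure.Carrier M → Bool) →
          ((b : Structure.Carrier M) → ⟦ dec ⟧ φ (e [ B /ₛv X ]) b ≡ true → B b ≡ true) →
          B a ≡ true) ⌋

Tautology : {Sig : Set} → Pattern Sig → Set₁
Tautology {Sig} φ =
  (M : Structure Sig) (F : Pattern Sig → Structure.Carrier M → Bool) →
  ((a : Structure.Carrier M) → F ⊥ᵖ a ≡ false) →
  ((ψ χ : Pattern Sig) (a : Structure.Carrier M) →
     F (ψ ⇒ χ) a ≡ not (F ψ a ∧ not (F χ a))) →
  (a : Structure.Carrier M) → F φ a ≡ true

data _⊢_ {Sig : Set} (Γ : Pattern Sig → Set) : Pattern Sig → Set₁ where
  hyp        : ∀ {φ} → Γ φ → Γ ⊢ φ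
  taut       : ∀ {φ} → Tautology φ → Γ ⊢ φ
  exQuant    : ∀ {φ x y} → FreeForₑ x (evar y) φ →
               Γ ⊢ ((φ [ evar y /ₑ x ]) ⇒ ex x φ)
  propBotL   : ∀ {φ} → Γ ⊢ (app ⊥ᵖ φ ⇒ ⊥ᵖ)
  propBotR   : ∀ {φ} → Γ ⊢ (app φ ⊥ᵖ ⇒ ⊥ᵖ)
  propDisjL  : ∀ {φ ψ χ} → Γ ⊢ (app (φ ∨ᵖ ψ) χ ⇒ (app φ χ ∨ᵖ app ψ χ))
  propDisjR  : ∀ {φ ψ χ} → Γ ⊢ (app χ (φ ∨ᵖ ψ) ⇒ (app χ φ ∨ᵖ app χ ψ))
  propExL    : ∀ {φ ψ x} → ¬ (x ∈FVₑ ψ) →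
               Γ ⊢ (app (ex x φ) ψ ⇒ ex x (app φ ψ))
  propExR    : ∀ {φ ψ x} → ¬ (x ∈FVₑ ψ) →
               Γ ⊢ (app ψ (ex x φ) ⇒ ex x (app ψ φ))
  prefixpt   : ∀ {φ X} → Positive X φ → FreeForₛ X (mu X φ) φ →
               Γ ⊢ ((φ [ mu X φ /ₛ X ]) ⇒ mu X φ)
  existence  : ∀ {x} → Γ ⊢ ex x (evar x)
  singleton  : ∀ {x φ} (C₁ C₂ : Ctx) →
               Γ ⊢ (¬ᵖ (plug C₁ (evar x ∧ᵖ φ) ∧ᵖ plug C₂ (evar x ∧ᵖ (¬ᵖ φ))))
  mp         : ∀ {φ ψ} → Γ ⊢ φ → Γ ⊢ (φ ⇒ ψ) → Γ ⊢ ψ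
  framingL   : ∀ {φ ψ χ} → Γ ⊢ (φ ⇒ ψ) → Γ ⊢ (app φ χ ⇒ app ψ χ)
  framingR   : ∀ {φ ψ χ} → Γ ⊢ (φ ⇒ ψ) → Γ ⊢ (app χ φ ⇒ app χ ψ)
  knasterTarski : ∀ {φ ψ X} → FreeForₛ X ψ φ →
               Γ ⊢ ((φ [ ψ /ₛ X ]) ⇒ ψ) → Γ ⊢ (mu X φ ⇒ ψ)

LocalConsequence : {Sig : Set} → Oracle → (Pattern Sig → Set) → Pattern Sig → Set₁
LocalConsequence {Sig} dec Γ φ =
  (M : Structure Sig) (e : Valuation M) →
  ((γ : Pattern Sig) → Γ γ → (a : Structure.Carrier M) → ⟦ dec ⟧ γ e a ≡ true) →
  (a : Structure.Carrier M) → ⟦ dec ⟧ φ e a ≡ true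

-- Soundness is proved for one structure and one valuation e at a time: every axiom
-- denotes the whole carrier under every valuation, and modus ponens, framing and
-- Knaster–Tarski preserve "denotes the whole carrier under e", which is exactly local
-- consequence. The substitution lemma
-- ⟦φ[δ/X]⟧e = ⟦φ⟧(e[⟦δ⟧e/X]) (and its analogue for element variables) holds under
-- the free-for side conditions, via the coincidence lemma. Monotonicity of ⟦φ⟧ in X
-- for positive φ makes ⟦μX.φ⟧, the intersection of all prefixpoints, itself a
-- prefixpoint, which validates the fixpoint axiom; Knaster–Tarski holds because
-- ⟦ψ⟧e is a prefixpoint whenever φ[ψ/X] → ψ is valid under e.

module Submission where

open import Defs
open import Data.Nat using (ℕ; _≟_)
open import Data.Bool using (Bool; true; false; not; _∧_; if_then_else_)
import Data.Bool.Properties as Bool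
open import Data.Empty using (⊥-elim)
open import Data.Product using (Σ; _×_; _,_; proj₁; proj₂)
open import Data.Sum using (_⊎_; inj₁; inj₂; [_,_])
open import Function.Base using (case_of_)
open import Relation.Nullary using (Dec; yes; no; ¬_; does)
open import Relation.Nullary.Decidable using (dec-true; dec-false; decidable-stable)
open import Relation.Binary.PropositionalEquality
  using (_≡_; _≢_; _≗_; refl; trans; cong-app; subst; subst₂; module ≡-Reasoning)
  renaming (sym to ≡-sym)

does-true⇒ : ∀ {P : Set} (P? : Dec P) → does P? ≡ true → P
does-true⇒ (yes p) _ = p

⇒ᵇ-intro : ∀ {p q} → (p ≡ true → q ≡ true) → not (p ∧ not q) ≡ true
⇒ᵇ-intro {true}  {true}  _ = refl
⇒ᵇ-intro {true}  {false} f = f refl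
⇒ᵇ-intro {false}         _ = refl

⇒ᵇ-elim : ∀ {p q} → not (p ∧ not q) ≡ true → p ≡ true → q ≡ true
⇒ᵇ-elim {true}  {true}  _  _ = refl
⇒ᵇ-elim {true}  {false} () _
⇒ᵇ-elim {false}         _  ()

≡true-⇔⇒≡ : ∀ {p q} → (p ≡ true → q ≡ true) → (q ≡ true → p ≡ true) → p ≡ q
≡true-⇔⇒≡ {true}          f _ = ≡-sym (f refl)
≡true-⇔⇒≡ {false} {true}  _ g = g refl
≡true-⇔⇒≡ {false} {false} _ _ = refl

infix 4 _⊆_

_⊆_ : ∀ {A : Set} → (A → Bool) → (A → Bool) → Set
B ⊆ C = ∀ a → B a ≡ true → C a ≡ true

module _ {A : Set} {B C : A → Bool} where

  ⊆-antisym : B ⊆ C → C ⊆ B → B ≗ C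
  ⊆-antisym B⊆C C⊆B a = ≡true-⇔⇒≡ (B⊆C a) (C⊆B a)

  ≗⇒⊆ : B ≗ C → B ⊆ C
  ≗⇒⊆ B≗C a = trans (≡-sym (B≗C a))

  ≗⇒⊇ : B ≗ C → C ⊆ B
  ≗⇒⊇ B≗C a = trans (B≗C a)

-- valE (e [ a /ₑv x ]) and valS (e [ B /ₛv X ]) compute to upd (valE e) x a and
-- upd (valS e) X B, so the lemmas below apply to valuation updates directly.
upd : ∀ {A : Set} → (ℕ → A) → ℕ → A → ℕ → A
upd f x a y = if does (y ≟ x) then a else f y

module _ {A : Set} where

  upd-≡ : ∀ (f : ℕ → A) {x y a} → y ≡ x → upd f x a y ≡ a
  upd-≡ _ {x} {y} y≡x rewrite dec-true (y ≟ x) y≡x = refl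

  upd-≢ : ∀ (f : ℕ → A) {x y a} → y ≢ x → upd f x a y ≡ f y
  upd-≢ _ {x} {y} y≢x rewrite dec-false (y ≟ x) y≢x = refl

  upd-pointwise : ∀ {ℓ} (R : A → A → Set ℓ) (f₁ f₂ : ℕ → A) {x y a₁ a₂} →
                  (y ≡ x → R a₁ a₂) → (y ≢ x → R (f₁ y) (f₂ y)) →
                  R (upd f₁ x a₁ y) (upd f₂ x a₂ y)
  upd-pointwise R f₁ f₂ {x} {y} same other with y ≟ x
  ... | yes y≡x = subst₂ R (≡-sym (upd-≡ f₁ y≡x)) (≡-sym (upd-≡ f₂ y≡x)) (same y≡x)
  ... | no  y≢x = subst₂ R (≡-sym (upd-≢ f₁ y≢x)) (≡-sym (upd-≢ f₂ y≢x)) (other y≢x)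

  upd-comm : ∀ (f : ℕ → A) {x z w a b} → z ≢ x →
             upd (upd f z b) x a w ≡ upd (upd f x a) z b w
  upd-comm f {x} {z} {w} {a} {b} z≢x with w ≟ x | w ≟ z
  ... | yes w≡x | yes w≡z = ⊥-elim (z≢x (trans (≡-sym w≡z) w≡x))
  ... | yes w≡x | no  w≢z = begin
    upd (upd f z b) x a w  ≡⟨ upd-≡ (upd f z b) w≡x ⟩
    a                      ≡⟨ upd-≡ f w≡x ⟨
    upd f x a w            ≡⟨ upd-≢ (upd f x a) w≢z ⟨
    upd (upd f x a) z b w  ∎
    where open ≡-Reasoning
  ... | no  w≢x | yes w≡z = begin
    upd (upd f z b) x a w  ≡⟨ upd-≢ (upd f z b) w≢x ⟩
    upd f z b w            ≡⟨ upd-≡ f w≡z ⟩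
    b                      ≡⟨ upd-≡ (upd f x a) w≡z ⟨
    upd (upd f x a) z b w  ∎
    where open ≡-Reasoning
  ... | no  w≢x | no  w≢z = begin
    upd (upd f z b) x a w  ≡⟨ upd-≢ (upd f z b) w≢x ⟩
    upd f z b w            ≡⟨ upd-≢ f w≢z ⟩
    f w                    ≡⟨ upd-≢ f w≢x ⟨
    upd f x a w            ≡⟨ upd-≢ (upd f x a) w≢z ⟨
    upd (upd f x a) z b w  ∎
    where open ≡-Reasoning

module Semantics (dec : Oracle) {Sig : Set} (M : Structure Sig) where
  open Structure M renaming (Carrier to A)
  open Valuation

  private variable
    φ φ₁ φ₂ ψ ψ₁ ψ₂ χ δ : Pattern Sig
    e e₁ e₂ : Valuation M
    a : A
    x x₁ x₂ y : EVar
    X X₁ X₂ Y : SVar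
    B C : A → Bool
    σ : Sig

  -- Opaque, so that unification can read the pattern back off its denotation.
  opaque
    ⟪_⟫ : Pattern Sig → Valuation M → A → Bool
    ⟪_⟫ = ⟦ dec ⟧

  infix 4 _∈⟪_⟫_ _⊨_

  _∈⟪_⟫_ : A → Pattern Sig → Valuation M → Set
  a ∈⟪ φ ⟫ e = ⟪ φ ⟫ e a ≡ true

  _⊨_ : Valuation M → Pattern Sig → Set
  e ⊨ φ = ∀ a → a ∈⟪ φ ⟫ e

  _∈_·_ : A → (A → Bool) → (A → Bool) → Set
  a ∈ B · C = Σ A λ b → Σ A λ c → B b ≡ true × C c ≡ true × appl b c a ≡ true

  PreFixpoint : SVar → Pattern Sig → Valuation M → (A → Bool) → Set
  PreFixpoint X φ e B = ⟪ φ ⟫ (e [ B /ₛv X ]) ⊆ B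

  opaque
    unfolding ⟪_⟫

    ⟪⟫≡⟦⟧ : ⟪ φ ⟫ e a ≡ ⟦ dec ⟧ φ e a
    ⟪⟫≡⟦⟧ = refl

    ⟪svar⟫ : ⟪ svar X ⟫ e ≡ valS e X
    ⟪svar⟫ = refl

    ⟪sym⟫ : ⟪ sym σ ⟫ e ≡ interp σ
    ⟪sym⟫ = refl

    ⟪⇒⟫ : ⟪ φ ⇒ ψ ⟫ e a ≡ not (⟪ φ ⟫ e a ∧ not (⟪ ψ ⟫ e a))
    ⟪⇒⟫ = refl

    ⟪⊥⟫ : ⟪ ⊥ᵖ ⟫ e a ≡ false
    ⟪⊥⟫ = dec-false (dec _) λ a∈⊥ → case a∈⊥ (λ _ → false) (λ _ b∈∅ → b∈∅) of λ ()

    ∈evar⁻ : a ∈⟪ evar x ⟫ e → a ≡ valE e x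
    ∈evar⁻ = does-true⇒ (dec _)

    ∈evar⁺ : a ≡ valE e x → a ∈⟪ evar x ⟫ e
    ∈evar⁺ = dec-true (dec _)

    ∈app⁻ : a ∈⟪ app φ ψ ⟫ e → a ∈ ⟪ φ ⟫ e · ⟪ ψ ⟫ e
    ∈app⁻ = does-true⇒ (dec _)

    ∈app⁺ : a ∈ ⟪ φ ⟫ e · ⟪ ψ ⟫ e → a ∈⟪ app φ ψ ⟫ e
    ∈app⁺ = dec-true (dec _)

    ∈ex⁻ : a ∈⟪ ex x φ ⟫ e → Σ A λ b → a ∈⟪ φ ⟫ (e [ b /ₑv x ])
    ∈ex⁻ = does-true⇒ (dec _)

    ∈ex⁺ : Σ A (λ b → a ∈⟪ φ ⟫ (e [ b /ₑv x ])) → a ∈⟪ ex x φ ⟫ e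
    ∈ex⁺ = dec-true (dec _)

    ∈mu⁻ : a ∈⟪ mu X φ ⟫ e → ∀ B → PreFixpoint X φ e B → B a ≡ true
    ∈mu⁻ = does-true⇒ (dec _)

    ∈mu⁺ : (∀ B → PreFixpoint X φ e B → B a ≡ true) → a ∈⟪ mu X φ ⟫ e
    ∈mu⁺ = dec-true (dec _)

  ∈⇒⁻ : a ∈⟪ φ ⇒ ψ ⟫ e → a ∈⟪ φ ⟫ e → a ∈⟪ ψ ⟫ e
  ∈⇒⁻ a∈φ⇒ψ = ⇒ᵇ-elim (trans (≡-sym ⟪⇒⟫) a∈φ⇒ψ)

  ∈⇒⁺ : (a ∈⟪ φ ⟫ e → a ∈⟪ ψ ⟫ e) → a ∈⟪ φ ⇒ ψ ⟫ e
  ∈⇒⁺ φ→ψ = trans ⟪⇒⟫ (⇒ᵇ-intro φ→ψ)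

  ⊨⇒⁻ : e ⊨ φ ⇒ ψ → ⟪ φ ⟫ e ⊆ ⟪ ψ ⟫ e
  ⊨⇒⁻ ⊨φ⇒ψ a = ∈⇒⁻ (⊨φ⇒ψ a)

  ⊨⇒⁺ : ⟪ φ ⟫ e ⊆ ⟪ ψ ⟫ e → e ⊨ φ ⇒ ψ
  ⊨⇒⁺ φ⊆ψ a = ∈⇒⁺ (φ⊆ψ a)

  ∉⊥ : ¬ a ∈⟪ ⊥ᵖ ⟫ e
  ∉⊥ {a} {e} a∈⊥ with trans (≡-sym a∈⊥) (⟪⊥⟫ {e} {a})
  ... | ()

  ∈? : ∀ φ e a → Dec (a ∈⟪ φ ⟫ e)
  ∈? φ e a = ⟪ φ ⟫ e a Bool.≟ true

  ∈¬⁻ : a ∈⟪ ¬ᵖ φ ⟫ e → ¬ a ∈⟪ φ ⟫ e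
  ∈¬⁻ a∈¬φ a∈φ = ∉⊥ (∈⇒⁻ a∈¬φ a∈φ)

  ∈¬⁺ : ¬ a ∈⟪ φ ⟫ e → a ∈⟪ ¬ᵖ φ ⟫ e
  ∈¬⁺ a∉φ = ∈⇒⁺ (λ a∈φ → ⊥-elim (a∉φ a∈φ))

  ∈∨⁻ : a ∈⟪ φ ∨ᵖ ψ ⟫ e → a ∈⟪ φ ⟫ e ⊎ a ∈⟪ ψ ⟫ e
  ∈∨⁻ {a} {φ} {e = e} a∈φ∨ψ with ∈? φ e a
  ... | yes a∈φ = inj₁ a∈φ
  ... | no  a∉φ = inj₂ (∈⇒⁻ a∈φ∨ψ (∈¬⁺ a∉φ))

  ∈∨⁺ˡ : a ∈⟪ φ ⟫ e → a ∈⟪ φ ∨ᵖ ψ ⟫ e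
  ∈∨⁺ˡ a∈φ = ∈⇒⁺ (λ a∈¬φ → ⊥-elim (∈¬⁻ a∈¬φ a∈φ))

  ∈∨⁺ʳ : a ∈⟪ ψ ⟫ e → a ∈⟪ φ ∨ᵖ ψ ⟫ e
  ∈∨⁺ʳ a∈ψ = ∈⇒⁺ (λ _ → a∈ψ)

  ∈∧⁻ : a ∈⟪ φ ∧ᵖ ψ ⟫ e → a ∈⟪ φ ⟫ e × a ∈⟪ ψ ⟫ e
  ∈∧⁻ {a} {φ} {ψ} {e} a∈φ∧ψ =
      decidable-stable (∈? φ e a) (λ a∉φ → ∈¬⁻ a∈φ∧ψ (∈∨⁺ˡ (∈¬⁺ a∉φ)))
    , decidable-stable (∈? ψ e a) (λ a∉ψ → ∈¬⁻ a∈φ∧ψ (∈∨⁺ʳ (∈¬⁺ a∉ψ)))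

  ·-mono : ∀ {B₁ B₂ C₁ C₂ : A → Bool} → B₁ ⊆ B₂ → C₁ ⊆ C₂ → a ∈ B₁ · C₁ → a ∈ B₂ · C₂
  ·-mono B⊆ C⊆ (b , c , b∈B , c∈C , a∈bc) = b , c , B⊆ b b∈B , C⊆ c c∈C , a∈bc

  app-mono : ⟪ φ₁ ⟫ e₁ ⊆ ⟪ φ₂ ⟫ e₂ → ⟪ ψ₁ ⟫ e₁ ⊆ ⟪ ψ₂ ⟫ e₂ →
             ⟪ app φ₁ ψ₁ ⟫ e₁ ⊆ ⟪ app φ₂ ψ₂ ⟫ e₂
  app-mono φ⊆ ψ⊆ a a∈ = ∈app⁺ (·-mono φ⊆ ψ⊆ (∈app⁻ a∈))

  ⇒-mono : ⟪ φ₂ ⟫ e₂ ⊆ ⟪ φ₁ ⟫ e₁ → ⟪ ψ₁ ⟫ e₁ ⊆ ⟪ ψ₂ ⟫ e₂ →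
           ⟪ φ₁ ⇒ ψ₁ ⟫ e₁ ⊆ ⟪ φ₂ ⇒ ψ₂ ⟫ e₂
  ⇒-mono φ⊇ ψ⊆ a a∈ = ∈⇒⁺ λ a∈φ₂ → ψ⊆ a (∈⇒⁻ a∈ (φ⊇ a a∈φ₂))

  ex-mono : (∀ b → ⟪ φ₁ ⟫ (e₁ [ b /ₑv x₁ ]) ⊆ ⟪ φ₂ ⟫ (e₂ [ b /ₑv x₂ ])) →
            ⟪ ex x₁ φ₁ ⟫ e₁ ⊆ ⟪ ex x₂ φ₂ ⟫ e₂
  ex-mono φ⊆ a a∈ with ∈ex⁻ a∈
  ... | b , a∈φ₁ = ∈ex⁺ (b , φ⊆ b a a∈φ₁)

  mu-mono : (∀ B → ⟪ φ₁ ⟫ (e₁ [ B /ₛv X₁ ]) ⊆ ⟪ φ₂ ⟫ (e₂ [ B /ₛv X₂ ])) →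
            ⟪ mu X₁ φ₁ ⟫ e₁ ⊆ ⟪ mu X₂ φ₂ ⟫ e₂
  mu-mono φ⊆ a a∈ = ∈mu⁺ λ B pre₂ → ∈mu⁻ a∈ B λ b b∈φ₁ → pre₂ b (φ⊆ B b b∈φ₁)

  evar-cong : valE e₁ x₁ ≡ valE e₂ x₂ → ⟪ evar x₁ ⟫ e₁ ≗ ⟪ evar x₂ ⟫ e₂
  evar-cong x₁≡x₂ = ⊆-antisym (λ _ a∈ → ∈evar⁺ (trans (∈evar⁻ a∈) x₁≡x₂))
                              (λ _ a∈ → ∈evar⁺ (trans (∈evar⁻ a∈) (≡-sym x₁≡x₂)))

  svar-cong : valS e₁ X₁ ≗ valS e₂ X₂ → ⟪ svar X₁ ⟫ e₁ ≗ ⟪ svar X₂ ⟫ e₂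
  svar-cong = subst₂ _≗_ (≡-sym ⟪svar⟫) (≡-sym ⟪svar⟫)

  sym-cong : ⟪ sym σ ⟫ e₁ ≗ ⟪ sym σ ⟫ e₂
  sym-cong = cong-app (trans ⟪sym⟫ (≡-sym ⟪sym⟫))

  app-cong : ⟪ φ₁ ⟫ e₁ ≗ ⟪ φ₂ ⟫ e₂ → ⟪ ψ₁ ⟫ e₁ ≗ ⟪ ψ₂ ⟫ e₂ →
             ⟪ app φ₁ ψ₁ ⟫ e₁ ≗ ⟪ app φ₂ ψ₂ ⟫ e₂
  app-cong φ≗ ψ≗ = ⊆-antisym (app-mono (≗⇒⊆ φ≗) (≗⇒⊆ ψ≗)) (app-mono (≗⇒⊇ φ≗) (≗⇒⊇ ψ≗))

  ⇒-cong : ⟪ φ₁ ⟫ e₁ ≗ ⟪ φ₂ ⟫ e₂ → ⟪ ψ₁ ⟫ e₁ ≗ ⟪ ψ₂ ⟫ e₂ →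
           ⟪ φ₁ ⇒ ψ₁ ⟫ e₁ ≗ ⟪ φ₂ ⇒ ψ₂ ⟫ e₂
  ⇒-cong φ≗ ψ≗ = ⊆-antisym (⇒-mono (≗⇒⊇ φ≗) (≗⇒⊆ ψ≗)) (⇒-mono (≗⇒⊆ φ≗) (≗⇒⊇ ψ≗))

  ex-cong : (∀ b → ⟪ φ₁ ⟫ (e₁ [ b /ₑv x₁ ]) ≗ ⟪ φ₂ ⟫ (e₂ [ b /ₑv x₂ ])) →
            ⟪ ex x₁ φ₁ ⟫ e₁ ≗ ⟪ ex x₂ φ₂ ⟫ e₂
  ex-cong φ≗ = ⊆-antisym (ex-mono (λ b → ≗⇒⊆ (φ≗ b))) (ex-mono (λ b → ≗⇒⊇ (φ≗ b)))

  mu-cong : (∀ B → ⟪ φ₁ ⟫ (e₁ [ B /ₛv X₁ ]) ≗ ⟪ φ₂ ⟫ (e₂ [ B /ₛv X₂ ])) →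
            ⟪ mu X₁ φ₁ ⟫ e₁ ≗ ⟪ mu X₂ φ₂ ⟫ e₂
  mu-cong φ≗ = ⊆-antisym (mu-mono (λ B → ≗⇒⊆ (φ≗ B))) (mu-mono (λ B → ≗⇒⊇ (φ≗ B)))

  record Agree (φ : Pattern Sig) (e₁ e₂ : Valuation M) : Set where
    constructor agree
    field
      onFVₑ : ∀ x → x ∈FVₑ φ → valE e₁ x ≡ valE e₂ x
      onFVₛ : ∀ X → X ∈FVₛ φ → valS e₁ X ≗ valS e₂ X

  agree-mono : (∀ {x} → x ∈FVₑ ψ → x ∈FVₑ φ) → (∀ {X} → X ∈FVₛ ψ → X ∈FVₛ φ) →
               Agree φ e₁ e₂ → Agree ψ e₁ e₂
  agree-mono FVₑ⊆ FVₛ⊆ (agree agreeₑ agreeₛ) =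
    agree (λ x x∈ψ → agreeₑ x (FVₑ⊆ x∈ψ)) (λ X X∈ψ → agreeₛ X (FVₛ⊆ X∈ψ))

  agree-ex : Agree (ex x φ) e₁ e₂ → ∀ b → Agree φ (e₁ [ b /ₑv x ]) (e₂ [ b /ₑv x ])
  agree-ex {e₁ = e₁} {e₂ = e₂} (agree agreeₑ agreeₛ) b =
    agree (λ y y∈φ → upd-pointwise _≡_ (valE e₁) (valE e₂) (λ _ → refl) (λ y≢x → agreeₑ y (y≢x , y∈φ)))
          agreeₛ

  agree-mu : Agree (mu X φ) e₁ e₂ → ∀ B → Agree φ (e₁ [ B /ₛv X ]) (e₂ [ B /ₛv X ])
  agree-mu {e₁ = e₁} {e₂ = e₂} (agree agreeₑ agreeₛ) B =
    agree agreeₑ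
          (λ Y Y∈φ → upd-pointwise _≗_ (valS e₁) (valS e₂) (λ _ _ → refl) (λ Y≢X → agreeₛ Y (Y≢X , Y∈φ)))

  agree-updₑ-fresh : ¬ x ∈FVₑ φ → Agree φ (e [ a /ₑv x ]) e
  agree-updₑ-fresh {φ = φ} {e = e} x∉φ =
    agree (λ y y∈φ → upd-≢ (valE e) (λ y≡x → x∉φ (subst (_∈FVₑ φ) y≡x y∈φ))) (λ _ _ _ → refl)

  agree-updₛ-fresh : ¬ X ∈FVₛ φ → Agree φ (e [ B /ₛv X ]) e
  agree-updₛ-fresh {φ = φ} {e = e} X∉φ =
    agree (λ _ _ → refl) (λ Y Y∈φ → cong-app (upd-≢ (valS e) (λ Y≡X → X∉φ (subst (_∈FVₛ φ) Y≡X Y∈φ))))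

  coincidence : ∀ φ → Agree φ e₁ e₂ → ⟪ φ ⟫ e₁ ≗ ⟪ φ ⟫ e₂
  coincidence (evar x) (agree agreeₑ _) = evar-cong (agreeₑ x refl)
  coincidence (svar X) (agree _ agreeₛ) = svar-cong (agreeₛ X refl)
  coincidence (sym σ) _ = sym-cong
  coincidence (app φ ψ) e₁≈e₂ =
    app-cong (coincidence φ (agree-mono inj₁ inj₁ e₁≈e₂)) (coincidence ψ (agree-mono inj₂ inj₂ e₁≈e₂))
  coincidence (φ ⇒ ψ) e₁≈e₂ =
    ⇒-cong (coincidence φ (agree-mono inj₁ inj₁ e₁≈e₂)) (coincidence ψ (agree-mono inj₂ inj₂ e₁≈e₂))
  coincidence (ex x φ) e₁≈e₂ = ex-cong λ b → coincidence φ (agree-ex e₁≈e₂ b)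
  coincidence (mu X φ) e₁≈e₂ = mu-cong λ B → coincidence φ (agree-mu e₁≈e₂ B)

  infix 4 _≤[_]_

  _≤[_]_ : Valuation M → SVar → Valuation M → Set
  e₁ ≤[ X ] e₂ = (∀ x → valE e₁ x ≡ valE e₂ x)
               × (∀ Y → Y ≢ X → valS e₁ Y ≗ valS e₂ Y)
               × valS e₁ X ⊆ valS e₂ X

  upd-≤ : B ⊆ C → (e [ B /ₛv X ]) ≤[ X ] (e [ C /ₛv X ])
  upd-≤ {e = e} B⊆C =
      (λ _ → refl)
    , (λ Y Y≢X → upd-pointwise _≗_ (valS e) (valS e) (λ Y≡X → ⊥-elim (Y≢X Y≡X)) (λ _ _ → refl))
    , subst₂ _⊆_ (≡-sym (upd-≡ (valS e) refl)) (≡-sym (upd-≡ (valS e) refl)) B⊆C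

  ≤-updₑ : e₁ ≤[ X ] e₂ → ∀ b → (e₁ [ b /ₑv x ]) ≤[ X ] (e₂ [ b /ₑv x ])
  ≤-updₑ {e₁ = e₁} {e₂ = e₂} (≡ₑ , ≡ₛ , ⊆X) b =
    (λ y → upd-pointwise _≡_ (valE e₁) (valE e₂) (λ _ → refl) (λ _ → ≡ₑ y)) , ≡ₛ , ⊆X

  ≤-updₛ : Y ≢ X → e₁ ≤[ X ] e₂ → ∀ B → (e₁ [ B /ₛv Y ]) ≤[ X ] (e₂ [ B /ₛv Y ])
  ≤-updₛ {Y = Y} {X = X} {e₁ = e₁} {e₂ = e₂} Y≢X (≡ₑ , ≡ₛ , ⊆X) B =
      ≡ₑ
    , (λ Z Z≢X → upd-pointwise _≗_ (valS e₁) (valS e₂) (λ _ _ → refl) (λ _ → ≡ₛ Z Z≢X))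
    , subst₂ _⊆_ (≡-sym (upd-≢ (valS e₁) X≢Y)) (≡-sym (upd-≢ (valS e₂) X≢Y)) ⊆X
    where X≢Y : X ≢ Y
          X≢Y X≡Y = Y≢X (≡-sym X≡Y)

  ≤-agree : e₁ ≤[ X ] e₂ → ¬ X ∈FVₛ φ → Agree φ e₁ e₂
  ≤-agree {φ = φ} (≡ₑ , ≡ₛ , _) X∉φ =
    agree (λ x _ → ≡ₑ x) (λ Y Y∈φ → ≡ₛ Y (λ Y≡X → X∉φ (subst (_∈FVₛ φ) Y≡X Y∈φ)))

  positive-monotone : ∀ φ → Positive X φ → e₁ ≤[ X ] e₂ → ⟪ φ ⟫ e₁ ⊆ ⟪ φ ⟫ e₂
  negative-antitone : ∀ φ → Negative X φ → e₁ ≤[ X ] e₂ → ⟪ φ ⟫ e₂ ⊆ ⟪ φ ⟫ e₁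

  positive-monotone (evar y) _ (≡ₑ , _) = ≗⇒⊆ (evar-cong (≡ₑ y))
  positive-monotone {X = X} (svar Y) _ (_ , ≡ₛ , ⊆X) with Y ≟ X
  ... | yes refl = subst₂ _⊆_ (≡-sym ⟪svar⟫) (≡-sym ⟪svar⟫) ⊆X
  ... | no  Y≢X  = ≗⇒⊆ (svar-cong (≡ₛ Y Y≢X))
  positive-monotone (sym σ) _ _ = ≗⇒⊆ sym-cong
  positive-monotone (app φ ψ) (φ⁺ , ψ⁺) ≤X =
    app-mono (positive-monotone φ φ⁺ ≤X) (positive-monotone ψ ψ⁺ ≤X)
  positive-monotone (φ ⇒ ψ) (φ⁻ , ψ⁺) ≤X =
    ⇒-mono (negative-antitone φ φ⁻ ≤X) (positive-monotone ψ ψ⁺ ≤X)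
  positive-monotone (ex y φ) φ⁺ ≤X = ex-mono λ b → positive-monotone φ φ⁺ (≤-updₑ ≤X b)
  positive-monotone {X = X} (mu Y φ) φ⁺ ≤X with Y ≟ X
  ... | yes refl = ≗⇒⊆ (coincidence (mu Y φ) (≤-agree ≤X λ (Y≢Y , _) → Y≢Y refl))
  ... | no  Y≢X rewrite dec-false (Y ≟ X) Y≢X =
    mu-mono λ B → positive-monotone φ φ⁺ (≤-updₛ Y≢X ≤X B)

  negative-antitone (evar y) _ (≡ₑ , _) = ≗⇒⊇ (evar-cong (≡ₑ y))
  negative-antitone (svar Y) Y≢X (_ , ≡ₛ , _) = ≗⇒⊇ (svar-cong (≡ₛ Y Y≢X))
  negative-antitone (sym σ) _ _ = ≗⇒⊇ sym-cong
  negative-antitone (app φ ψ) (φ⁻ , ψ⁻) ≤X =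
    app-mono (negative-antitone φ φ⁻ ≤X) (negative-antitone ψ ψ⁻ ≤X)
  negative-antitone (φ ⇒ ψ) (φ⁺ , ψ⁻) ≤X =
    ⇒-mono (positive-monotone φ φ⁺ ≤X) (negative-antitone ψ ψ⁻ ≤X)
  negative-antitone (ex y φ) φ⁻ ≤X = ex-mono λ b → negative-antitone φ φ⁻ (≤-updₑ ≤X b)
  negative-antitone {X = X} (mu Y φ) φ⁻ ≤X with Y ≟ X
  ... | yes refl = ≗⇒⊇ (coincidence (mu Y φ) (≤-agree ≤X λ (Y≢Y , _) → Y≢Y refl))
  ... | no  Y≢X rewrite dec-false (Y ≟ X) Y≢X =
    mu-mono λ B → negative-antitone φ φ⁻ (≤-updₛ Y≢X ≤X B)

  substitutionₑ : ∀ φ → FreeForₑ x (evar y) φ →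
                  ⟪ φ [ evar y /ₑ x ] ⟫ e ≗ ⟪ φ ⟫ (e [ valE e y /ₑv x ])
  substitutionₑ {x = x} {e = e} (evar w) _ with w ≟ x
  ... | yes w≡x rewrite dec-true (w ≟ x) w≡x = evar-cong (≡-sym (upd-≡ (valE e) w≡x))
  ... | no  w≢x rewrite dec-false (w ≟ x) w≢x = evar-cong (≡-sym (upd-≢ (valE e) w≢x))
  substitutionₑ (svar X) _ = svar-cong (λ _ → refl)
  substitutionₑ (sym σ) _ = sym-cong
  substitutionₑ (app φ ψ) (φ-free , ψ-free) =
    app-cong (substitutionₑ φ φ-free) (substitutionₑ ψ ψ-free)
  substitutionₑ (φ ⇒ ψ) (φ-free , ψ-free) =
    ⇒-cong (substitutionₑ φ φ-free) (substitutionₑ ψ ψ-free)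
  substitutionₑ {x = x} {y} {e} (ex z θ) free with z ≟ x
  ... | yes z≡x rewrite dec-true (z ≟ x) z≡x =
    λ a → ≡-sym (coincidence (ex z θ) (agree-updₑ-fresh λ (x≢z , _) → x≢z (≡-sym z≡x)) a)
  ... | no  z≢x rewrite dec-false (z ≟ x) z≢x =
    ex-cong λ b a → trans (substitutionₑ θ (proj₂ free) a) (coincidence θ (agreement b) a)
    where
      agreement : ∀ b → Agree θ ((e [ b /ₑv z ]) [ valE (e [ b /ₑv z ]) y /ₑv x ])
                                ((e [ valE e y /ₑv x ]) [ b /ₑv z ])
      agreement b = agree (λ w w∈θ → trans (upd-pointwise _≡_ (upd (valE e) z b) (upd (valE e) z b)
                                              (λ w≡x → upd-≢ (valE e) (y≢z w≡x w∈θ)) (λ _ → refl))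
                                            (upd-comm (valE e) {w = w} z≢x))
                          (λ _ _ _ → refl)
        where y≢z : ∀ {w} → w ≡ x → w ∈FVₑ θ → y ≢ z
              y≢z w≡x w∈θ y≡z = proj₁ free (≡-sym y≡z) (subst (_∈FVₑ θ) w≡x w∈θ)
  substitutionₑ (mu X θ) (_ , θ-free) = mu-cong λ B → substitutionₑ θ θ-free

  substitutionₛ : ∀ φ → FreeForₛ X δ φ →
                  ⟪ φ [ δ /ₛ X ] ⟫ e ≗ ⟪ φ ⟫ (e [ ⟪ δ ⟫ e /ₛv X ])
  substitutionₛ (evar x) _ = evar-cong refl
  substitutionₛ {X = X} {e = e} (svar Y) _ with Y ≟ X
  ... | yes Y≡X rewrite dec-true (Y ≟ X) Y≡X = cong-app (≡-sym (trans ⟪svar⟫ (upd-≡ (valS e) Y≡X)))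
  ... | no  Y≢X rewrite dec-false (Y ≟ X) Y≢X = svar-cong (cong-app (≡-sym (upd-≢ (valS e) Y≢X)))
  substitutionₛ (sym σ) _ = sym-cong
  substitutionₛ (app φ ψ) (φ-free , ψ-free) =
    app-cong (substitutionₛ φ φ-free) (substitutionₛ ψ ψ-free)
  substitutionₛ (φ ⇒ ψ) (φ-free , ψ-free) =
    ⇒-cong (substitutionₛ φ φ-free) (substitutionₛ ψ ψ-free)
  substitutionₛ {X = X} {δ} {e} (ex z θ) (z-bound , θ-free) =
    ex-cong λ b a → trans (substitutionₛ θ θ-free a) (coincidence θ (agreement b) a)
    where
      agreement : ∀ b → Agree θ ((e [ b /ₑv z ]) [ ⟪ δ ⟫ (e [ b /ₑv z ]) /ₛv X ])
                                ((e [ ⟪ δ ⟫ e /ₛv X ]) [ b /ₑv z ])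
      agreement b = agree (λ _ _ → refl)
        (λ Y Y∈θ → upd-pointwise _≗_ (valS e) (valS e)
                     (λ Y≡X → coincidence δ (agree-updₑ-fresh λ z∈δ →
                                z-bound z∈δ (subst (_∈FVₛ θ) Y≡X Y∈θ)))
                     (λ _ _ → refl))
  substitutionₛ {X = X} {δ} {e} (mu Z θ) free with Z ≟ X
  ... | yes Z≡X rewrite dec-true (Z ≟ X) Z≡X =
    λ a → ≡-sym (coincidence (mu Z θ) (agree-updₛ-fresh λ (X≢Z , _) → X≢Z (≡-sym Z≡X)) a)
  ... | no  Z≢X rewrite dec-false (Z ≟ X) Z≢X =
    mu-cong λ B a → trans (substitutionₛ θ (proj₂ free) a) (coincidence θ (agreement B) a)
    where
      agreement : ∀ B → Agree θ ((e [ B /ₛv Z ]) [ ⟪ δ ⟫ (e [ B /ₛv Z ]) /ₛv X ])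
                                ((e [ ⟪ δ ⟫ e /ₛv X ]) [ B /ₛv Z ])
      agreement B = agree (λ _ _ → refl)
        (λ Y Y∈θ c → trans (upd-pointwise _≗_ (upd (valS e) Z B) (upd (valS e) Z B)
                              (λ Y≡X → coincidence δ (agree-updₛ-fresh λ Z∈δ →
                                         proj₁ free Z∈δ (subst (_∈FVₛ θ) Y≡X Y∈θ)))
                              (λ _ _ → refl) c)
                            (cong-app (upd-comm (valS e) {w = Y} Z≢X) c))

  ∈plug⇒inhabited : ∀ C → a ∈⟪ plug C δ ⟫ e → Σ A λ b → b ∈⟪ δ ⟫ e
  ∈plug⇒inhabited □ a∈δ = _ , a∈δ
  ∈plug⇒inhabited (ctxL C _) a∈ = let (b , _ , b∈ , _) = ∈app⁻ a∈ in ∈plug⇒inhabited C b∈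
  ∈plug⇒inhabited (ctxR _ C) a∈ = let (_ , c , _ , c∈ , _) = ∈app⁻ a∈ in ∈plug⇒inhabited C c∈

  ⊨-taut : Tautology φ → e ⊨ φ
  ⊨-taut {e = e} tautology = tautology M (λ ψ → ⟪ ψ ⟫ e) (λ _ → ⟪⊥⟫) (λ _ _ _ → ⟪⇒⟫)

  ⊨-exQuant : FreeForₑ x (evar y) φ → e ⊨ (φ [ evar y /ₑ x ]) ⇒ ex x φ
  ⊨-exQuant {y = y} {φ = φ} {e = e} free =
    ⊨⇒⁺ λ a a∈ → ∈ex⁺ (valE e y , ≗⇒⊆ (substitutionₑ φ free) a a∈)

  ⊨-propBotL : e ⊨ app ⊥ᵖ φ ⇒ ⊥ᵖ
  ⊨-propBotL = ⊨⇒⁺ λ a a∈ → let (_ , _ , b∈⊥ , _) = ∈app⁻ a∈ in ⊥-elim (∉⊥ b∈⊥)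

  ⊨-propBotR : e ⊨ app φ ⊥ᵖ ⇒ ⊥ᵖ
  ⊨-propBotR = ⊨⇒⁺ λ a a∈ → let (_ , _ , _ , c∈⊥ , _) = ∈app⁻ a∈ in ⊥-elim (∉⊥ c∈⊥)

  ⊨-propDisjL : e ⊨ app (φ ∨ᵖ ψ) χ ⇒ (app φ χ ∨ᵖ app ψ χ)
  ⊨-propDisjL = ⊨⇒⁺ λ a a∈ → let (b , c , b∈φ∨ψ , c∈χ , a∈bc) = ∈app⁻ a∈ in
    [ (λ b∈φ → ∈∨⁺ˡ (∈app⁺ (b , c , b∈φ , c∈χ , a∈bc)))
    , (λ b∈ψ → ∈∨⁺ʳ (∈app⁺ (b , c , b∈ψ , c∈χ , a∈bc))) ] (∈∨⁻ b∈φ∨ψ)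

  ⊨-propDisjR : e ⊨ app χ (φ ∨ᵖ ψ) ⇒ (app χ φ ∨ᵖ app χ ψ)
  ⊨-propDisjR = ⊨⇒⁺ λ a a∈ → let (b , c , b∈χ , c∈φ∨ψ , a∈bc) = ∈app⁻ a∈ in
    [ (λ c∈φ → ∈∨⁺ˡ (∈app⁺ (b , c , b∈χ , c∈φ , a∈bc)))
    , (λ c∈ψ → ∈∨⁺ʳ (∈app⁺ (b , c , b∈χ , c∈ψ , a∈bc))) ] (∈∨⁻ c∈φ∨ψ)

  ⊨-propExL : ¬ x ∈FVₑ ψ → e ⊨ app (ex x φ) ψ ⇒ ex x (app φ ψ)
  ⊨-propExL {ψ = ψ} x∉ψ = ⊨⇒⁺ λ a a∈ →
    let (b , c , b∈∃φ , c∈ψ , a∈bc) = ∈app⁻ a∈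
        (d , b∈φ) = ∈ex⁻ b∈∃φ
    in ∈ex⁺ (d , ∈app⁺ (b , c , b∈φ , ≗⇒⊇ (coincidence ψ (agree-updₑ-fresh x∉ψ)) c c∈ψ , a∈bc))

  ⊨-propExR : ¬ x ∈FVₑ ψ → e ⊨ app ψ (ex x φ) ⇒ ex x (app ψ φ)
  ⊨-propExR {ψ = ψ} x∉ψ = ⊨⇒⁺ λ a a∈ →
    let (b , c , b∈ψ , c∈∃φ , a∈bc) = ∈app⁻ a∈
        (d , c∈φ) = ∈ex⁻ c∈∃φ
    in ∈ex⁺ (d , ∈app⁺ (b , c , ≗⇒⊇ (coincidence ψ (agree-updₑ-fresh x∉ψ)) b b∈ψ , c∈φ , a∈bc))

  ⊨-prefixpt : Positive X φ → FreeForₛ X (mu X φ) φ → e ⊨ (φ [ mu X φ /ₛ X ]) ⇒ mu X φ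
  ⊨-prefixpt {X = X} {φ = φ} pos free = ⊨⇒⁺ λ a a∈ → ∈mu⁺ λ B B-pre →
    B-pre a (positive-monotone φ pos (upd-≤ λ b b∈μ → ∈mu⁻ b∈μ B B-pre) a
              (≗⇒⊆ (substitutionₛ φ free) a a∈))

  ⊨-existence : e ⊨ ex x (evar x)
  ⊨-existence {e = e} a = ∈ex⁺ (a , ∈evar⁺ (≡-sym (upd-≡ (valE e) refl)))

  ⊨-singleton : ∀ C₁ C₂ → e ⊨ ¬ᵖ (plug C₁ (evar x ∧ᵖ φ) ∧ᵖ plug C₂ (evar x ∧ᵖ (¬ᵖ φ)))
  ⊨-singleton {e = e} {φ = φ} C₁ C₂ a = ∈¬⁺ λ a∈ →
    let (a∈C₁ , a∈C₂) = ∈∧⁻ a∈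
        (b₁ , b₁∈) = ∈plug⇒inhabited C₁ a∈C₁
        (b₂ , b₂∈) = ∈plug⇒inhabited C₂ a∈C₂
        (b₁≡x , b₁∈φ) = ∈∧⁻ b₁∈
        (b₂≡x , b₂∈¬φ) = ∈∧⁻ b₂∈
    in ∈¬⁻ b₂∈¬φ (subst (_∈⟪ φ ⟫ e) (trans (∈evar⁻ b₁≡x) (≡-sym (∈evar⁻ b₂≡x))) b₁∈φ)

  ⊨-framingL : e ⊨ φ ⇒ ψ → e ⊨ app φ χ ⇒ app ψ χ
  ⊨-framingL ⊨φ⇒ψ = ⊨⇒⁺ (app-mono (⊨⇒⁻ ⊨φ⇒ψ) (λ _ c∈ → c∈))

  ⊨-framingR : e ⊨ φ ⇒ ψ → e ⊨ app χ φ ⇒ app χ ψ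
  ⊨-framingR ⊨φ⇒ψ = ⊨⇒⁺ (app-mono (λ _ b∈ → b∈) (⊨⇒⁻ ⊨φ⇒ψ))

  ⊨-knasterTarski : FreeForₛ X ψ φ → e ⊨ (φ [ ψ /ₛ X ]) ⇒ ψ → e ⊨ mu X φ ⇒ ψ
  ⊨-knasterTarski {ψ = ψ} {φ = φ} {e = e} free ⊨φ[ψ]⇒ψ = ⊨⇒⁺ λ a a∈μ →
    ∈mu⁻ a∈μ (⟪ ψ ⟫ e) λ b b∈ → ⊨⇒⁻ ⊨φ[ψ]⇒ψ b (≗⇒⊇ (substitutionₛ φ free) b b∈)

  soundness : ∀ {Γ} → (∀ γ → Γ γ → e ⊨ γ) → Γ ⊢ φ → e ⊨ φ
  soundness ⊨Γ (hyp γ∈Γ) = ⊨Γ _ γ∈Γ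
  soundness ⊨Γ (taut t) = ⊨-taut t
  soundness ⊨Γ (exQuant free) = ⊨-exQuant free
  soundness ⊨Γ propBotL = ⊨-propBotL
  soundness ⊨Γ propBotR = ⊨-propBotR
  soundness ⊨Γ propDisjL = ⊨-propDisjL
  soundness ⊨Γ propDisjR = ⊨-propDisjR
  soundness ⊨Γ (propExL x∉ψ) = ⊨-propExL x∉ψ
  soundness ⊨Γ (propExR x∉ψ) = ⊨-propExR x∉ψ
  soundness ⊨Γ (prefixpt pos free) = ⊨-prefixpt pos free
  soundness ⊨Γ existence = ⊨-existence
  soundness ⊨Γ (singleton C₁ C₂) = ⊨-singleton C₁ C₂
  soundness ⊨Γ (mp ⊢φ ⊢φ⇒ψ) a = ∈⇒⁻ (soundness ⊨Γ ⊢φ⇒ψ a) (soundness ⊨Γ ⊢φ a)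
  soundness ⊨Γ (framingL ⊢φ⇒ψ) = ⊨-framingL (soundness ⊨Γ ⊢φ⇒ψ)
  soundness ⊨Γ (framingR ⊢φ⇒ψ) = ⊨-framingR (soundness ⊨Γ ⊢φ⇒ψ)
  soundness ⊨Γ (knasterTarski free ⊢φ[ψ]⇒ψ) = ⊨-knasterTarski free (soundness ⊨Γ ⊢φ[ψ]⇒ψ)

mainTheorem2 : (dec : Oracle) {Sig : Set} (Γ : Pattern Sig → Set) (φ : Pattern Sig) →
    Γ ⊢ φ → LocalConsequence dec Γ φ
mainTheorem2 dec Γ φ Γ⊢φ M e ⊨Γ a =
  trans (≡-sym ⟪⟫≡⟦⟧) (soundness (λ γ γ∈Γ b → trans ⟪⟫≡⟦⟧ (⊨Γ γ γ∈Γ b)) Γ⊢φ a)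
  where open Semantics dec M
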